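{- If $T$ is a tree with at least $3$ vertices, then $\zeta^*(T)=2$.
   Context: The centroidal localization game on a graph $G$ with parameter $k$: the robber is secretly placed at a vertex $r$; at each turn the Cop-player probes a set $\{v_1,\dots,v_k\}$ of (at most) $k$ vertices and learns, for each $v_i$, whether $d(v_i,r)=0$, and for every $i<j$ whether $d(v_i,r)$ is $<$, $=$ or $>$ $d(v_j,r)$ ($d$ = graph distance). If all information gathered uniquely determines the robber's current position, the Cop-player wins; otherwise the robber may move along one edge (or stay). The robber wins if never located. $\zeta^*(G)$ is the minimum $k$ for which the Cop-player has a strategy winning against every robber strategy. -}

module Defs where

open import Data.Nat using (ℕ; zero; suc; _≤_; _<_; _<ᵇ_; _≡ᵇ_)
open import Data.Bool using (Bool; true; false; _∨_; _∧_; if_then_else_; T)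
open import Data.Fin using (Fin; toℕ)
open import Data.Fin.Properties using (_≟_)
open import Data.List using (List; []; _∷_; _∷ʳ_; length; allFin)
open import Data.Bool.ListAction using (any)
open import Data.List.Relation.Unary.Unique.Propositional using (Unique)
open import Data.Vec using (Vec; tabulate; lookup)
open import Data.Maybe using (Maybe; just; nothing)
open import Data.Product using (Σ; ∃; _×_; _,_)
open import Data.Sum using (_⊎_)
open import Relation.Binary.PropositionalEquality using (_≡_)
open import Relation.Nullary using (¬_; does)

record Graph (n : ℕ) : Set where
  field
    adj     : Fin n → Fin n → Bool
    adj-sym : ∀ u v → adj u v ≡ adj v u
    adj-irr : ∀ v → adj v v ≡ false

module _ {n : ℕ} (G : Graph n) where
  open Graph G

  Adj : Fin n → Fin n → Set
  Adj u v = T (adj u v)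

  data Walk : Fin n → Fin n → ℕ → Set where
    here : ∀ {u} → Walk u u 0
    step : ∀ {u w v ℓ} → Adj u w → Walk w v ℓ → Walk u v (suc ℓ)

  Connected : Set
  Connected = ∀ u v → Σ ℕ (λ ℓ → Walk u v ℓ)

  data Chain : List (Fin n) → Set where
    chain[] : Chain []
    chain1  : ∀ {x} → Chain (x ∷ [])
    chain∷  : ∀ {x y xs} → Adj x y → Chain (y ∷ xs) → Chain (x ∷ y ∷ xs)

  -- a cycle: distinct vertices h, x₁, …, x_m (m ≥ 2, so ≥ 3 vertices),
  -- consecutive ones adjacent and the last adjacent to h
  HasCycle : Set
  HasCycle = Σ (Fin n) λ h → Σ (List (Fin n)) λ xs →
               (2 ≤ length xs) × Unique (h ∷ xs) × Chain ((h ∷ xs) ∷ʳ h)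

  IsTree : Set
  IsTree = Connected × ¬ HasCycle

  -- reach m u v = true  iff  there is a walk from u to v of length ≤ m
  reach : ℕ → Fin n → Fin n → Bool
  reach zero    u v = does (u ≟ v)
  reach (suc m) u v = reach m u v ∨ any (λ w → reach m u w ∧ adj w v) (allFin n)

  leastFrom : (ℕ → Bool) → ℕ → ℕ → ℕ
  leastFrom p m zero       = m
  leastFrom p m (suc fuel) = if p m then m else leastFrom p (suc m) fuel

  -- d(u,v): least length of a walk from u to v (every such length is < n
  -- when a walk exists)
  dist : Fin n → Fin n → ℕ
  dist u v = leastFrom (λ m → reach m u v) 0 n

data Cmp : Set where
  LT EQ GT : Cmp

cmp : ℕ → ℕ → Cmp
cmp a b = if a <ᵇ b then LT else (if a ≡ᵇ b then EQ else GT)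

-- a probe of (at most) k vertices: k vertices, repetitions allowed
Probe : ℕ → ℕ → Set
Probe n k = Vec (Fin n) k

-- answer to a probe: for each i whether d(vᵢ,r)=0, and for each i<j the
-- comparison of d(vᵢ,r) with d(vⱼ,r) (nothing recorded for i ≥ j)
Answer : ℕ → Set
Answer k = Vec Bool k × Vec (Vec (Maybe Cmp) k) k

module _ {n : ℕ} (G : Graph n) {k : ℕ} where

  answer : Probe n k → Fin n → Answer k
  answer vs r =
    tabulate (λ i → dist G (lookup vs i) r ≡ᵇ 0) ,
    tabulate (λ i → tabulate (λ j →
      if toℕ i <ᵇ toℕ j
      then just (cmp (dist G (lookup vs i) r) (dist G (lookup vs j) r))
      else nothing))

  -- a (deterministic) Cop strategy chooses the next probe from the
  -- answers received so far (most recent first)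
  CopStrategy : Set
  CopStrategy = List (Answer k) → Probe n k

  RobberWalk : (ℕ → Fin n) → Set
  RobberWalk r = ∀ t → r (suc t) ≡ r t ⊎ Adj G (r t) (r (suc t))

  history : CopStrategy → (ℕ → Fin n) → ℕ → List (Answer k)
  history σ r zero    = []
  history σ r (suc t) = answer (σ (history σ r t)) (r t) ∷ history σ r t

  -- after the probe of turn t, the gathered information determines r t
  LocatedAt : CopStrategy → (ℕ → Fin n) → ℕ → Set
  LocatedAt σ r t = ∀ r' → RobberWalk r' →
                    history σ r' (suc t) ≡ history σ r (suc t) → r' t ≡ r t

  WinningStrategy : CopStrategy → Set
  WinningStrategy σ = ∀ r → RobberWalk r → ∃ λ t → LocatedAt σ r t

CopWins : ∀ {n} → Graph n → ℕ → Set
CopWins G k = ∃ λ (σ : CopStrategy G {k}) → WinningStrategy G σ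

ZetaStarIs : ∀ {n} → Graph n → ℕ → Set
ZetaStarIs G m = CopWins G m × (∀ k → k < m → ¬ CopWins G k)

module Submission where

-- Upper bound.  Root T at ρ.  The Cop keeps a state (x, k) with the invariant
-- that the robber is at x or below a child of x of index ≥ k, and probes the
-- pair (c, x) where c is the vertex of index k if that is a child of x (else
-- c = x).  For a child c of x, d(c,r) < d(x,r) exactly when r lies in the
-- subtree of c; so the Cop descends to (c, 0) or moves on to (x, k+1), and a
-- robber taking one step stays confined because the only edge leaving the
-- subtree of c is c–x.  The measure (n ∸ depth x)·(n+1) + (n ∸ k) decreases
-- each turn, so eventually a probe hits the robber.
--
-- Lower bound.  With at most one probe the Cop learns only whether it hit.
-- A tree with ≥ 3 vertices contains a path a–b–c; one robber on {a,b} and one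
-- on {b,c} both dodge every probe, so their histories never differ.

open import Defs
open import Data.Nat using (ℕ; zero; suc; pred; _+_; _*_; _∸_; _≤_; _<_; z≤n; s≤s; s≤s⁻¹; _<ᵇ_; _≡ᵇ_; _≤?_; _<?_)
open import Data.Nat.Properties hiding (_≟_)
open import Data.Nat.Properties using () renaming (_≟_ to _≟ℕ_)
open import Data.Nat.Induction using (<-wellFounded)
open import Induction.WellFounded using (Acc; acc)
open import Data.Empty using (⊥; ⊥-elim)
open import Data.Bool using (Bool; true; false; T; if_then_else_)
open import Data.Bool.Properties using (T-∨; T-∧)
open import Data.Maybe using (Maybe; just; nothing)
open import Data.Fin using (Fin; toℕ; zero; suc; fromℕ<)
open import Data.Fin.Properties using (_≟_; toℕ<n; pigeonhole; any?; toℕ-fromℕ<; toℕ-injective)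
open import Data.List using (List; []; _∷_; _∷ʳ_; allFin; replicate)
open import Data.List.Properties using (length-++-≤ʳ; ∷-injective)
open import Data.List.Relation.Unary.All using (All; []; _∷_)
import Data.List.Relation.Unary.All as All
open import Data.List.Relation.Unary.All.Properties using (∷ʳ⁺; ∷ʳ⁻)
open import Data.List.Relation.Unary.AllPairs using ([]; _∷_)
import Data.List.Relation.Unary.AllPairs.Properties as AllPairs
open import Data.List.Relation.Unary.Unique.Propositional using (Unique)
open import Data.List.Relation.Unary.Any using (satisfied)
open import Data.List.Relation.Unary.Any.Properties using (any⁺; any⁻)
open import Data.List.Membership.Propositional using (lose)
open import Data.List.Membership.Propositional.Properties using (∈-allFin)
open import Data.Vec using ([]; _∷_; lookup)
open import Data.Vec.Properties using (lookup∘tabulate)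
open import Data.Product using (Σ; ∃; _×_; _,_; proj₁; proj₂)
open import Data.Sum using (_⊎_; inj₁; inj₂)
open import Function using (_∘_)
open import Function.Bundles using (Equivalence)
open import Relation.Binary.Definitions using (tri<; tri≈; tri>)
open import Relation.Binary.PropositionalEquality
open import Relation.Nullary using (¬_; Dec; yes; no)
open import Relation.Nullary.Decidable using (T?; _×-dec_)

unique-snoc : ∀ {A : Set} {xs : List A} {y} → Unique xs → All (_≢ y) xs → Unique (xs ∷ʳ y)
unique-snoc u y∉ = AllPairs.++⁺ u ([] ∷ []) (All.map (_∷ []) y∉)

pred-∸ : ∀ m k → pred m ∸ k ≡ pred (m ∸ k)
pred-∸ m k = trans (∸-+-assoc m 1 k) (sym (pred[m∸n]≡m∸[1+n] m k))

∸-gap : ∀ {m k} → k < m → m ∸ k ≡ suc (m ∸ suc k)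
∸-gap {suc m} {zero}  _         = refl
∸-gap {suc m} {suc k} (s≤s k<m) = ∸-gap k<m

-- A path on three vertices a–b–c (so a ≠ b ≠ c ≠ a).
ThreePath : ∀ {n} → Graph n → Set
ThreePath {n} G = Σ (Fin n) λ a → Σ (Fin n) λ b → Σ (Fin n) λ c → Adj G a b × Adj G b c × a ≢ c

module Distance {n : ℕ} (G : Graph n) where
  open Graph G

  Adj-sym : ∀ {u v} → Adj G u v → Adj G v u
  Adj-sym {u} {v} = subst T (adj-sym u v)

  Adj-irrefl : ∀ {u v} → Adj G u v → u ≢ v
  Adj-irrefl {u} e refl = subst T (adj-irr u) e

  walk-snoc : ∀ {u w v ℓ} → Walk G u w ℓ → Adj G w v → Walk G u v (suc ℓ)
  walk-snoc here       e′ = step e′ here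
  walk-snoc (step e p) e′ = step e (walk-snoc p e′)

  walk-++ : ∀ {u w v ℓ ℓ′} → Walk G u w ℓ → Walk G w v ℓ′ → Walk G u v (ℓ + ℓ′)
  walk-++ here       q = q
  walk-++ (step e p) q = step e (walk-++ p q)

  chain-snoc : ∀ xs {b c} → Chain G (xs ∷ʳ b) → Adj G b c → Chain G (xs ∷ʳ b ∷ʳ c)
  chain-snoc []           _              e = chain∷ e chain1
  chain-snoc (_ ∷ [])     (chain∷ e′ _)  e = chain∷ e′ (chain∷ e chain1)
  chain-snoc (_ ∷ y ∷ xs) (chain∷ e′ ch) e = chain∷ e′ (chain-snoc (y ∷ xs) ch e)

  reach-refl : ∀ u → T (reach G 0 u u)
  reach-refl u with u ≟ u
  ... | yes _  = _
  ... | no u≢u = u≢u refl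

  reach-0⇒≡ : ∀ {u v} → T (reach G 0 u v) → u ≡ v
  reach-0⇒≡ {u} {v} r with u ≟ v
  ... | yes u≡v = u≡v

  reach-extend : ∀ {m u w v} → T (reach G m u w) → Adj G w v → T (reach G (suc m) u v)
  reach-extend {m} {u} {w} {v} r e =
    Equivalence.from (T-∨ {reach G m u v}) (inj₂ (any⁺ _ (lose (∈-allFin w) (Equivalence.from T-∧ (r , e)))))

  reach-++ : ∀ {m u w v ℓ} → T (reach G m u w) → Walk G w v ℓ → T (reach G (m + ℓ) u v)
  reach-++ {m} r here rewrite +-identityʳ m = r
  reach-++ {m} {u} {ℓ = suc ℓ} r (step e p) rewrite +-suc m ℓ = reach-++ {suc m} (reach-extend {m} {u} r e) p

  reach⇒walk : ∀ m {u v} → T (reach G m u v) → Σ ℕ λ ℓ → ℓ ≤ m × Walk G u v ℓ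
  reach⇒walk zero {u} {v} r with reach-0⇒≡ {u} {v} r
  ... | refl = 0 , z≤n , here
  reach⇒walk (suc m) {u} {v} r with Equivalence.to (T-∨ {reach G m u v}) r
  ... | inj₁ r′ = let ℓ , ℓ≤m , p = reach⇒walk m r′ in ℓ , m≤n⇒m≤1+n ℓ≤m , p
  ... | inj₂ r′ with satisfied (any⁻ _ (allFin n) r′)
  ... | w , rw with Equivalence.to (T-∧ {reach G m u w}) rw
  ... | r″ , e = let ℓ , ℓ≤m , p = reach⇒walk m r″ in suc ℓ , s≤s ℓ≤m , walk-snoc p e

  leastFrom-≤ : ∀ p m fuel j → T (p j) → m ≤ j → j < m + fuel → leastFrom G p m fuel ≤ j
  leastFrom-≤ p m zero j _ m≤j j<m rewrite +-identityʳ m = ⊥-elim (<⇒≱ j<m m≤j)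
  leastFrom-≤ p m (suc fuel) j pj m≤j j<m+f with p m in pm
  ... | true = m≤j
  ... | false with m ≟ℕ j
  ...   | yes refl = ⊥-elim (subst T pm pj)
  ...   | no m≢j   = leastFrom-≤ p (suc m) fuel j pj (≤∧≢⇒< m≤j m≢j) (subst (j <_) (+-suc m fuel) j<m+f)

  leastFrom-bound : ∀ p m fuel → leastFrom G p m fuel ≤ m + fuel
  leastFrom-bound p m zero = ≤-reflexive (sym (+-identityʳ m))
  leastFrom-bound p m (suc fuel) with p m
  ... | true  = m≤m+n m (suc fuel)
  ... | false = subst (leastFrom G p (suc m) fuel ≤_) (sym (+-suc m fuel)) (leastFrom-bound p (suc m) fuel)

  leastFrom-found : ∀ p m fuel → leastFrom G p m fuel < m + fuel → T (p (leastFrom G p m fuel))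
  leastFrom-found p m zero lt = ⊥-elim (<-irrefl (sym (+-identityʳ m)) lt)
  leastFrom-found p m (suc fuel) lt with p m in pm
  ... | true  = subst T (sym pm) _
  ... | false = leastFrom-found p (suc m) fuel (subst (leastFrom G p (suc m) fuel <_) (+-suc m fuel) lt)

  -- A walk of length ≥ n visits n + 1 positions, so by pigeonhole it repeats a
  -- vertex and the closed detour between the repetitions can be cut out.

  vertexAt : ∀ {u v ℓ} → Walk G u v ℓ → ℕ → Fin n
  vertexAt {u} here       _       = u
  vertexAt {u} (step _ _) zero    = u
  vertexAt     (step _ p) (suc i) = vertexAt p i

  walk-take : ∀ {u v ℓ} (p : Walk G u v ℓ) i → i ≤ ℓ → Walk G u (vertexAt p i) i
  walk-take here       zero    _         = here
  walk-take (step _ _) zero    _         = here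
  walk-take (step e p) (suc i) (s≤s i≤ℓ) = step e (walk-take p i i≤ℓ)

  walk-drop : ∀ {u v ℓ} (p : Walk G u v ℓ) i → i ≤ ℓ → Walk G (vertexAt p i) v (ℓ ∸ i)
  walk-drop here       zero    _         = here
  walk-drop (step e p) zero    _         = step e p
  walk-drop (step _ p) (suc i) (s≤s i≤ℓ) = walk-drop p i i≤ℓ

  shortcut : ∀ {u v ℓ} → Walk G u v ℓ → n ≤ ℓ → Σ ℕ λ ℓ′ → ℓ′ < ℓ × Walk G u v ℓ′
  shortcut {v = v} {ℓ} p n≤ℓ with pigeonhole (s≤s n≤ℓ) (λ i → vertexAt p (toℕ i))
  ... | i , j , i<j , same =
    toℕ i + (ℓ ∸ toℕ j) , shorter ,
    walk-++ (walk-take p (toℕ i) i≤ℓ) (subst (λ x → Walk G x v (ℓ ∸ toℕ j)) (sym same) (walk-drop p (toℕ j) j≤ℓ))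
    where
      j≤ℓ : toℕ j ≤ ℓ
      j≤ℓ = s≤s⁻¹ (toℕ<n j)
      i≤ℓ : toℕ i ≤ ℓ
      i≤ℓ = ≤-trans (<⇒≤ i<j) j≤ℓ
      shorter : toℕ i + (ℓ ∸ toℕ j) < ℓ
      shorter = begin-strict
        toℕ i + (ℓ ∸ toℕ j) <⟨ +-monoˡ-< (ℓ ∸ toℕ j) i<j ⟩
        toℕ j + (ℓ ∸ toℕ j) ≡⟨ m+[n∸m]≡n j≤ℓ ⟩
        ℓ                   ∎
        where open ≤-Reasoning

  short-walk : ∀ {u v ℓ} → Acc _<_ ℓ → Walk G u v ℓ → Σ ℕ λ ℓ′ → ℓ′ < n × Walk G u v ℓ′
  short-walk {ℓ = ℓ} (acc shorter) p with n ≤? ℓ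
  ... | no n≰ℓ  = ℓ , ≰⇒> n≰ℓ , p
  ... | yes n≤ℓ = let ℓ′ , ℓ′<ℓ , p′ = shortcut p n≤ℓ in short-walk (shorter ℓ′<ℓ) p′

  dist-≤-n : ∀ u v → dist G u v ≤ n
  dist-≤-n u v = leastFrom-bound (λ m → reach G m u v) 0 n

  dist-reach : ∀ {u v} → dist G u v < n → T (reach G (dist G u v) u v)
  dist-reach {u} {v} = leastFrom-found (λ m → reach G m u v) 0 n

  dist-≤-walk : ∀ {u v ℓ} → Walk G u v ℓ → dist G u v ≤ ℓ
  dist-≤-walk {u} {v} {ℓ} p with ℓ <? n
  ... | yes ℓ<n = leastFrom-≤ _ 0 n ℓ (reach-++ {0} (reach-refl u) p) z≤n ℓ<n
  ... | no ℓ≮n  = ≤-trans (dist-≤-n u v) (≮⇒≥ ℓ≮n)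

  geodesic : ∀ {u v ℓ} → Walk G u v ℓ → Walk G u v (dist G u v)
  geodesic {u} {v} p with short-walk (<-wellFounded _) p
  ... | ℓ₁ , ℓ₁<n , p₁ with reach⇒walk (dist G u v) (dist-reach (≤-<-trans (dist-≤-walk p₁) ℓ₁<n))
  ... | ℓ₂ , ℓ₂≤d , p₂ = subst (Walk G u v) (≤-antisym ℓ₂≤d (dist-≤-walk p₂)) p₂

  dist-refl : ∀ u → dist G u u ≡ 0
  dist-refl u = n≤0⇒n≡0 (dist-≤-walk {u} here)

  dist≡0⇒≡ : ∀ {u v} → dist G u v ≡ 0 → u ≡ v
  dist≡0⇒≡ {u} {v} d≡0 = reach-0⇒≡ (subst (λ m → T (reach G m u v)) d≡0 (dist-reach d<n))
    where
      d<n : dist G u v < n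
      d<n = subst (_< n) (sym d≡0) (≤-<-trans z≤n (toℕ<n u))

  miss-bit : ∀ {u v} → u ≢ v → (dist G u v ≡ᵇ 0) ≡ false
  miss-bit {u} {v} u≢v with dist G u v in d≡
  ... | zero  = ⊥-elim (u≢v (dist≡0⇒≡ d≡))
  ... | suc _ = refl

  probe-hit : ∀ {k} (P : Probe n k) i {y z} → answer G P y ≡ answer G P z → z ≡ lookup P i → y ≡ z
  probe-hit P i {y} {z} same z≡v = sym (trans z≡v v≡y)
    where
      bits : (dist G (lookup P i) y ≡ᵇ 0) ≡ (dist G (lookup P i) z ≡ᵇ 0)
      bits = begin
        dist G (lookup P i) y ≡ᵇ 0       ≡⟨ lookup∘tabulate (λ j → dist G (lookup P j) y ≡ᵇ 0) i ⟨
        lookup (proj₁ (answer G P y)) i ≡⟨ cong (λ a → lookup (proj₁ a) i) same ⟩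
        lookup (proj₁ (answer G P z)) i ≡⟨ lookup∘tabulate (λ j → dist G (lookup P j) z ≡ᵇ 0) i ⟩
        dist G (lookup P i) z ≡ᵇ 0       ∎
        where open ≡-Reasoning
      hit-z : T (dist G (lookup P i) z ≡ᵇ 0)
      hit-z = ≡⇒≡ᵇ _ 0 (trans (cong (dist G (lookup P i)) z≡v) (dist-refl (lookup P i)))
      v≡y : lookup P i ≡ y
      v≡y = dist≡0⇒≡ (≡ᵇ⇒≡ _ 0 (subst T (sym bits) hit-z))

  probe-miss : ∀ {k} (P : Probe n k) i {y z} → answer G P y ≡ answer G P z → z ≢ lookup P i → y ≢ lookup P i
  probe-miss P i same z≢v y≡v = z≢v (trans (probe-hit P i (sym same) y≡v) y≡v)

module RootedTree {n : ℕ} (G : Graph n) (connected : Connected G) (acyclic : ¬ HasCycle G) (ρ : Fin n) where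
  open Graph G
  open Distance G

  shortest : ∀ u v → Walk G u v (dist G u v)
  shortest u v = geodesic (proj₂ (connected u v))

  depth : Fin n → ℕ
  depth y = dist G y ρ

  depth-root : depth ρ ≡ 0
  depth-root = dist-refl ρ

  depth≡0⇒root : ∀ {y} → depth y ≡ 0 → y ≡ ρ
  depth≡0⇒root = dist≡0⇒≡

  depth-suc⇒nonroot : ∀ {y d} → depth y ≡ suc d → y ≢ ρ
  depth-suc⇒nonroot d≡ refl = 0≢1+n (trans (sym depth-root) d≡)

  depth-adj : ∀ {y z} → Adj G y z → depth y ≤ suc (depth z)
  depth-adj {z = z} e = dist-≤-walk (step e (shortest z ρ))

  LowerNbr : Fin n → Fin n → Set
  LowerNbr y w = Adj G y w × suc (depth w) ≡ depth y

  -- The second vertex of a shortest walk to the root is a lower neighbour.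
  lowerNbr-exists : ∀ {y} → y ≢ ρ → ∃ (LowerNbr y)
  lowerNbr-exists {y} y≢ρ with depth y in d≡ | shortest y ρ
  ... | zero  | _ = ⊥-elim (y≢ρ (depth≡0⇒root d≡))
  ... | suc ℓ | step {w = w} e p =
    w , e , ≤-antisym (s≤s (dist-≤-walk p)) (subst (_≤ suc (depth w)) d≡ (depth-adj e))

  lowerNbr? : ∀ y → Dec (∃ (LowerNbr y))
  lowerNbr? y = any? λ w → T? (adj y w) ×-dec (suc (depth w) ≟ℕ depth y)

  -- The parent of y is a lower neighbour (unique, by lowerNbr-unique below);
  -- the root is its own parent.
  parent : Fin n → Fin n
  parent y with lowerNbr? y
  ... | yes (w , _) = w
  ... | no _        = ρ

  parent-lower : ∀ {y} → y ≢ ρ → LowerNbr y (parent y)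
  parent-lower {y} y≢ρ with lowerNbr? y
  ... | yes (_ , lower) = lower
  ... | no none         = ⊥-elim (none (lowerNbr-exists y≢ρ))

  parent-adj : ∀ {y} → y ≢ ρ → Adj G y (parent y)
  parent-adj y≢ρ = proj₁ (parent-lower y≢ρ)

  depth-parent : ∀ y → depth (parent y) ≡ pred (depth y)
  depth-parent y with lowerNbr? y
  ... | yes (_ , _ , d≡) = cong pred d≡
  ... | no none with y ≟ ρ
  ...   | yes refl = trans depth-root (cong pred (sym depth-root))
  ...   | no y≢ρ   = ⊥-elim (none (lowerNbr-exists y≢ρ))

  -- Two distinct vertices a, b of equal depth d
  -- cannot be joined by a path without repeated vertices whose interior Q
  -- stays at depth ≥ d: replacing a, b by their parents gives the same
  -- configuration one level up, until the two parents coincide and close a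
  -- cycle (at depth 0 we would have a = ρ = b).
  no-level-path : ∀ d a b Q → depth a ≡ d → depth b ≡ d → All (λ v → d ≤ depth v) Q →
                  Chain G (a ∷ Q ∷ʳ b) → Unique (a ∷ Q ∷ʳ b) → ⊥
  no-level-path zero a b Q da db _ _ (a∉ ∷ _) =
    proj₂ (∷ʳ⁻ a∉) (trans (depth≡0⇒root da) (sym (depth≡0⇒root db)))
  no-level-path (suc d) a b Q da db deepQ path distinct = climb (parent a ≟ parent b)
    where
      depth-pa : depth (parent a) ≡ d
      depth-pa = trans (depth-parent a) (cong pred da)
      depth-pb : depth (parent b) ≡ d
      depth-pb = trans (depth-parent b) (cong pred db)
      a↑ : Adj G a (parent a)
      a↑ = parent-adj (depth-suc⇒nonroot da)
      b↑ : Adj G b (parent b)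
      b↑ = parent-adj (depth-suc⇒nonroot db)
      deep : All (λ v → suc d ≤ depth v) (a ∷ Q ∷ʳ b)
      deep = ≤-reflexive (sym da) ∷ ∷ʳ⁺ deepQ (≤-reflexive (sym db))
      shallower : ∀ {p v} → depth p ≡ d → suc d ≤ depth v → p ≢ v
      shallower dp dv refl = <-irrefl (sym dp) dv
      climb : Dec (parent a ≡ parent b) → ⊥
      climb (yes same) =
        acyclic (parent a , a ∷ Q ∷ʳ b , s≤s (length-++-≤ʳ (b ∷ []) {Q}) ,
                 All.map (shallower depth-pa) deep ∷ distinct ,
                 chain∷ (Adj-sym a↑) (chain-snoc (a ∷ Q) path (subst (Adj G b) (sym same) b↑)))
      climb (no differ) =
        no-level-path d (parent a) (parent b) (a ∷ Q ∷ʳ b) depth-pa depth-pb (All.map (≤-trans (n≤1+n d)) deep)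
          (chain∷ (Adj-sym a↑) (chain-snoc (a ∷ Q) path b↑))
          (∷ʳ⁺ (All.map (shallower depth-pa) deep) differ ∷
           unique-snoc distinct (All.map (λ dv → shallower depth-pb dv ∘ sym) deep))

  -- Instance Q = [y]: every vertex has at most one lower neighbour.
  lowerNbr-unique : ∀ {y a b} → LowerNbr y a → LowerNbr y b → a ≡ b
  lowerNbr-unique {y} {a} {b} (ya , da) (yb , db) with a ≟ b
  ... | yes a≡b = a≡b
  ... | no a≢b  =
    ⊥-elim (no-level-path (depth a) a b (y ∷ []) refl (suc-injective (trans db (sym da)))
              (subst (depth a ≤_) da (n≤1+n _) ∷ []) (chain∷ (Adj-sym ya) (chain∷ yb chain1))
              ((Adj-irrefl (Adj-sym ya) ∷ a≢b ∷ []) ∷ (Adj-irrefl yb ∷ []) ∷ [] ∷ []))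

  -- Instance Q = []: no edge joins two vertices of the same depth.
  no-level-edge : ∀ {y z} → Adj G y z → depth z ≢ depth y
  no-level-edge e same =
    no-level-path _ _ _ [] refl (sym same) [] (chain∷ (Adj-sym e) chain1) ((Adj-irrefl (Adj-sym e) ∷ []) ∷ [] ∷ [])

  IsChild : Fin n → Fin n → Set
  IsChild x c = parent c ≡ x × depth c ≡ suc (depth x)

  isChild? : ∀ x c → Dec (IsChild x c)
  isChild? x c = (parent c ≟ x) ×-dec (depth c ≟ℕ suc (depth x))

  neighbour-cases : ∀ {y z} → Adj G y z → (y ≢ ρ × z ≡ parent y) ⊎ IsChild y z
  neighbour-cases {y} {z} e with <-cmp (depth z) (depth y)
  ... | tri< z<y _ _ = inj₁ (y≢ρ , lowerNbr-unique (e , z↓) (parent-lower y≢ρ))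
    where
      z↓ : suc (depth z) ≡ depth y
      z↓ = ≤-antisym z<y (depth-adj e)
      y≢ρ : y ≢ ρ
      y≢ρ = depth-suc⇒nonroot (sym z↓)
  ... | tri≈ _ same _ = ⊥-elim (no-level-edge e same)
  ... | tri> _ _ y<z = inj₂ (lowerNbr-unique (parent-lower z≢ρ) (Adj-sym e , sym y↓) , y↓)
    where
      y↓ : depth z ≡ suc (depth y)
      y↓ = ≤-antisym (depth-adj (Adj-sym e)) y<z
      z≢ρ : z ≢ ρ
      z≢ρ = depth-suc⇒nonroot y↓

  ancestor : ℕ → Fin n → Fin n
  ancestor zero    y = y
  ancestor (suc i) y = ancestor i (parent y)

  depth-ancestor : ∀ i y → depth (ancestor i y) ≡ depth y ∸ i
  depth-ancestor zero    y = refl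
  depth-ancestor (suc i) y = begin
    depth (ancestor i (parent y)) ≡⟨ depth-ancestor i (parent y) ⟩
    depth (parent y) ∸ i          ≡⟨ cong (_∸ i) (depth-parent y) ⟩
    pred (depth y) ∸ i            ≡⟨ pred-∸ (depth y) i ⟩
    pred (depth y ∸ i)            ≡⟨ pred[m∸n]≡m∸[1+n] (depth y) i ⟩
    depth y ∸ suc i               ∎
    where open ≡-Reasoning

  ancestor-suc : ∀ i y → ancestor (suc i) y ≡ parent (ancestor i y)
  ancestor-suc zero    y = refl
  ancestor-suc (suc i) y = ancestor-suc i (parent y)

  -- x ≼ y: x is an ancestor of y, i.e. y lies in the subtree rooted at x.
  _≼_ : Fin n → Fin n → Set
  x ≼ y = ancestor (depth y ∸ depth x) y ≡ x

  _≼?_ : ∀ x y → Dec (x ≼ y)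
  x ≼? y = ancestor (depth y ∸ depth x) y ≟ x

  ≼-depth : ∀ {x y} → x ≼ y → depth x ≤ depth y
  ≼-depth {x} {y} x≼y = begin
    depth x                                ≡⟨ cong depth (sym x≼y) ⟩
    depth (ancestor (depth y ∸ depth x) y) ≡⟨ depth-ancestor (depth y ∸ depth x) y ⟩
    depth y ∸ (depth y ∸ depth x)          ≤⟨ m∸n≤m (depth y) (depth y ∸ depth x) ⟩
    depth y                                ∎
    where open ≤-Reasoning

  ≼-refl : ∀ x → x ≼ x
  ≼-refl x = cong (λ i → ancestor i x) (n∸n≡0 (depth x))

  ≼-root : ∀ y → ρ ≼ y
  ≼-root y = depth≡0⇒root (begin
    depth (ancestor (depth y ∸ depth ρ) y) ≡⟨ depth-ancestor (depth y ∸ depth ρ) y ⟩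
    depth y ∸ (depth y ∸ depth ρ)          ≡⟨ m∸[m∸n]≡n (subst (_≤ depth y) (sym depth-root) z≤n) ⟩
    depth ρ                                ≡⟨ depth-root ⟩
    0                                      ∎)
    where open ≡-Reasoning

  ≼-child : ∀ {x z y} → IsChild z y → x ≼ z → x ≼ y
  ≼-child {x} {z} {y} (pz , dy) x≼z = begin
    ancestor (depth y ∸ depth x) y          ≡⟨ cong (λ i → ancestor i y) gap ⟩
    ancestor (depth z ∸ depth x) (parent y) ≡⟨ cong (ancestor (depth z ∸ depth x)) pz ⟩
    ancestor (depth z ∸ depth x) z          ≡⟨ x≼z ⟩
    x                                       ∎
    where
      open ≡-Reasoning
      gap : depth y ∸ depth x ≡ suc (depth z ∸ depth x)
      gap = trans (cong (_∸ depth x) dy) (+-∸-assoc 1 (≼-depth x≼z))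

  ≼-parent : ∀ {x y} → x ≼ y → y ≢ x → x ≼ parent y
  ≼-parent {x} {y} x≼y y≢x with depth y ∸ depth x in gap
  ... | zero  = ⊥-elim (y≢x x≼y)
  ... | suc j = trans (cong (λ i → ancestor i (parent y)) gap′) x≼y
    where
      gap′ : depth (parent y) ∸ depth x ≡ j
      gap′ = trans (cong (_∸ depth x) (depth-parent y)) (trans (pred-∸ (depth y) (depth x)) (cong pred gap))

  ≼-branch : ∀ {x y} → x ≼ y → y ≢ x → Σ (Fin n) λ c → IsChild x c × c ≼ y
  ≼-branch {x} {y} x≼y y≢x with depth y ∸ depth x in gap
  ... | zero  = ⊥-elim (y≢x x≼y)
  ... | suc j = ancestor j y , (trans (sym (ancestor-suc j y)) x≼y , depth-c) , c≼y
    where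
      j<dy : j < depth y
      j<dy = subst (_≤ depth y) gap (m∸n≤m (depth y) (depth x))
      depth-c : depth (ancestor j y) ≡ suc (depth x)
      depth-c = begin
        depth (ancestor j y)             ≡⟨ depth-ancestor j y ⟩
        depth y ∸ j                      ≡⟨ ∸-gap j<dy ⟩
        suc (depth y ∸ suc j)            ≡⟨ cong suc (sym (depth-ancestor (suc j) y)) ⟩
        suc (depth (ancestor (suc j) y)) ≡⟨ cong (suc ∘ depth) x≼y ⟩
        suc (depth x)                    ∎
        where open ≡-Reasoning
      c≼y : ancestor j y ≼ y
      c≼y = cong (λ i → ancestor i y) (trans (cong (depth y ∸_) (depth-ancestor j y)) (m∸[m∸n]≡n (<⇒≤ j<dy)))

  ≼-exit : ∀ {x u w} → Adj G u w → x ≼ u → ¬ x ≼ w → u ≡ x × w ≡ parent x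
  ≼-exit {x} {u} {w} e x≼u x⋠w with neighbour-cases e
  ... | inj₂ u→w = ⊥-elim (x⋠w (≼-child u→w x≼u))
  ... | inj₁ (_ , w≡pu) with u ≟ x
  ...   | yes u≡x = u≡x , trans w≡pu (cong parent u≡x)
  ...   | no u≢x  = ⊥-elim (x⋠w (subst (x ≼_) (sym w≡pu) (≼-parent x≼u u≢x)))

  walk-leaving : ∀ {x a b ℓ} → Walk G a b ℓ → x ≼ a → ¬ x ≼ b → Σ ℕ λ ℓ′ → ℓ′ < ℓ × Walk G (parent x) b ℓ′
  walk-leaving here x≼a x⋠b = ⊥-elim (x⋠b x≼a)
  walk-leaving {x} (step {w = w} {ℓ = ℓ} e p) x≼a x⋠b with x ≼? w
  ... | yes x≼w = let ℓ′ , ℓ′<ℓ , q = walk-leaving p x≼w x⋠b in ℓ′ , m<n⇒m<1+n ℓ′<ℓ , q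
  ... | no x⋠w  = ℓ , n<1+n ℓ , subst (λ v → Walk G v _ ℓ) (proj₂ (≼-exit e x≼a x⋠w)) p

  walk-entering : ∀ {x a b ℓ} → Walk G a b ℓ → ¬ x ≼ a → x ≼ b → Σ ℕ λ ℓ′ → ℓ′ < ℓ × Walk G x b ℓ′
  walk-entering here x⋠a x≼b = ⊥-elim (x⋠a x≼b)
  walk-entering {x} (step {w = w} {ℓ = ℓ} e p) x⋠a x≼b with x ≼? w
  ... | yes x≼w = ℓ , n<1+n ℓ , subst (λ v → Walk G v _ ℓ) (proj₁ (≼-exit (Adj-sym e) x≼w x⋠a)) p
  ... | no x⋠w  = let ℓ′ , ℓ′<ℓ , q = walk-entering p x⋠w x≼b in ℓ′ , m<n⇒m<1+n ℓ′<ℓ , q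

  closer-to-child : ∀ {x c y} → IsChild x c → c ≼ y → dist G c y < dist G x y
  closer-to-child {x} {c} {y} (_ , dc) c≼y =
    let ℓ , ℓ<d , p = walk-entering (shortest x y) c⋠x c≼y in ≤-<-trans (dist-≤-walk p) ℓ<d
    where
      c⋠x : ¬ c ≼ x
      c⋠x c≼x = 1+n≰n (subst (_≤ depth x) dc (≼-depth c≼x))

  closer-to-parent : ∀ {x c y} → IsChild x c → ¬ c ≼ y → dist G x y < dist G c y
  closer-to-parent {x} {c} {y} (pc , _) c⋠y =
    let ℓ , ℓ<d , p = walk-leaving (shortest c y) (≼-refl c) c⋠y
    in ≤-<-trans (dist-≤-walk (subst (λ v → Walk G v y ℓ) pc p)) ℓ<d

  grandparent-path : ∀ {y d} → depth y ≡ suc (suc d) → ThreePath G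
  grandparent-path {y} {d} dy =
    y , parent y , parent (parent y) , parent-adj (depth-suc⇒nonroot dy) , parent-adj (depth-suc⇒nonroot dpy) ,
    λ y≡ppy → <-irrefl (sym (trans (sym dy) (trans (cong depth y≡ppy) dppy))) (m<n⇒m<1+n (n<1+n d))
    where
      dpy : depth (parent y) ≡ suc d
      dpy = trans (depth-parent y) (cong pred dy)
      dppy : depth (parent (parent y)) ≡ d
      dppy = trans (depth-parent (parent y)) (cong pred dpy)

  child-of-root : ∀ {y} → depth y ≡ 1 → Adj G y ρ
  child-of-root {y} dy =
    subst (Adj G y) (depth≡0⇒root (trans (depth-parent y) (cong pred dy))) (parent-adj (depth-suc⇒nonroot dy))

  -- Two further vertices u ≠ v besides the root yield a path on three
  -- vertices: either one of them has a grandparent, or u–ρ–v.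
  three-path : ∀ u v → u ≢ ρ → v ≢ ρ → u ≢ v → ThreePath G
  three-path u v u≢ρ v≢ρ u≢v with depth u in du | depth v in dv
  ... | zero        | _           = ⊥-elim (u≢ρ (depth≡0⇒root du))
  ... | _           | zero        = ⊥-elim (v≢ρ (depth≡0⇒root dv))
  ... | suc (suc _) | _           = grandparent-path du
  ... | _           | suc (suc _) = grandparent-path dv
  ... | suc zero    | suc zero    = u , ρ , v , child-of-root du , Adj-sym (child-of-root dv) , u≢v

module Strategy {n : ℕ} (G : Graph n) (connected : Connected G) (acyclic : ¬ HasCycle G) (ρ : Fin n) where
  open Distance G
  open RootedTree G connected acyclic ρ

  -- A state (x, k): x is the current vertex, children of index < k are ruled out.
  State : Set
  State = Fin n × ℕ

  Confined : State → Fin n → Set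
  Confined (x , k) y = y ≡ x ⊎ Σ (Fin n) λ c → IsChild x c × k ≤ toℕ c × c ≼ y

  candidate : State → Fin n
  candidate (x , k) with k <? n
  ... | no _ = x
  ... | yes k<n with isChild? x (fromℕ< k<n)
  ...   | yes _ = fromℕ< k<n
  ...   | no _  = x

  NoChildAt : Fin n → ℕ → Set
  NoChildAt x k = ∀ c → IsChild x c → toℕ c ≢ k

  Candidate : State → Fin n → Set
  Candidate (x , k) c = (IsChild x c × toℕ c ≡ k) ⊎ (c ≡ x × NoChildAt x k)

  candidate-spec : ∀ s → Candidate s (candidate s)
  candidate-spec (x , k) with k <? n
  ... | no k≮n = inj₂ (refl , λ c _ c≡k → k≮n (subst (_< n) c≡k (toℕ<n c)))
  ... | yes k<n with isChild? x (fromℕ< k<n)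
  ...   | yes child = inj₁ (child , toℕ-fromℕ< k<n)
  ...   | no ¬child = inj₂ (refl , λ c child c≡k →
                          ¬child (subst (IsChild x) (toℕ-injective (trans c≡k (sym (toℕ-fromℕ< k<n)))) child))

  probe : State → Probe n 2
  probe s = candidate s ∷ proj₁ s ∷ []

  closer : Maybe Cmp → Bool
  closer (just LT) = true
  closer _         = false

  closer-cmp : ∀ a b → closer (just (cmp a b)) ≡ (a <ᵇ b)
  closer-cmp a b with a <ᵇ b
  ... | true  = refl
  ... | false with a ≡ᵇ b
  ...   | true  = refl
  ...   | false = refl

  -- Descend to c if the first probed vertex c was strictly closer to the
  -- robber than the second one x; otherwise rule out the next index.
  next : State → Fin n → Answer 2 → State
  next (x , k) c a = if closer (lookup (lookup (proj₂ a) zero) (suc zero)) then (c , 0) else (x , suc k)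

  next-on-answer : ∀ x k c z → next (x , k) c (answer G (c ∷ x ∷ []) z) ≡
                                (if dist G c z <ᵇ dist G x z then (c , 0) else (x , suc k))
  next-on-answer x k c z = cong (λ b → if b then (c , 0) else (x , suc k)) (closer-cmp (dist G c z) (dist G x z))

  state : List (Answer 2) → State
  state []       = ρ , 0
  state (a ∷ as) = next (state as) (candidate (state as)) a

  cop : CopStrategy G {2}
  cop as = probe (state as)

  Step : Fin n → Fin n → Set
  Step y w = w ≡ y ⊎ Adj G y w

  stay-or-exit : ∀ {c y w} → c ≼ y → Step y w → c ≼ w ⊎ (y ≡ c × w ≡ parent c)
  stay-or-exit c≼y (inj₁ refl) = inj₁ c≼y
  stay-or-exit {c} {w = w} c≼y (inj₂ e) with c ≼? w
  ... | yes c≼w = inj₁ c≼w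
  ... | no c⋠w  = inj₂ (≼-exit e c≼y c⋠w)

  confined-below : ∀ {x y} → x ≼ y → Confined (x , 0) y
  confined-below {x} {y} x≼y with y ≟ x
  ... | yes y≡x = inj₁ y≡x
  ... | no y≢x  = let c , child , c≼y = ≼-branch x≼y y≢x in inj₂ (c , child , z≤n , c≼y)

  descend : ∀ {x c y w} → IsChild x c → c ≼ y → y ≢ c → Step y w → Confined (c , 0) w
  descend _ c≼y y≢c st with stay-or-exit c≼y st
  ... | inj₁ c≼w       = confined-below c≼w
  ... | inj₂ (y≡c , _) = ⊥-elim (y≢c y≡c)

  advance : ∀ {x k y w} → Confined (x , k) y → y ≢ x → (∀ c → IsChild x c → toℕ c ≡ k → ¬ c ≼ y) →
            Step y w → Confined (x , suc k) w
  advance (inj₁ y≡x) y≢x _ _ = ⊥-elim (y≢x y≡x)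
  advance (inj₂ (c , child , k≤c , c≼y)) _ excluded st with stay-or-exit c≼y st
  ... | inj₁ c≼w        = inj₂ (c , child , ≤∧≢⇒< k≤c (λ k≡c → excluded c child (sym k≡c) c≼y) , c≼w)
  ... | inj₂ (_ , w≡pc) = inj₁ (trans w≡pc (proj₁ child))

  turn : ∀ {x k c y z w} → Candidate (x , k) c → Confined (x , k) y →
         answer G (c ∷ x ∷ []) y ≡ answer G (c ∷ x ∷ []) z → z ≢ c → z ≢ x → Step y w →
         Confined (next (x , k) c (answer G (c ∷ x ∷ []) z)) w
  turn {x} {k} {c} {y} {z} {w} cand conf same z≢c z≢x st =
    subst (λ s → Confined s w) (sym next≡) (outcome cand (dist G c y <ᵇ dist G x y) refl)
    where
      y≢c : y ≢ c
      y≢c = probe-miss (c ∷ x ∷ []) zero same z≢c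
      y≢x : y ≢ x
      y≢x = probe-miss (c ∷ x ∷ []) (suc zero) same z≢x
      same-bit : (dist G c y <ᵇ dist G x y) ≡ (dist G c z <ᵇ dist G x z)
      same-bit = trans (sym (closer-cmp (dist G c y) (dist G x y)))
                   (trans (cong (λ a → closer (lookup (lookup (proj₂ a) zero) (suc zero))) same)
                          (closer-cmp (dist G c z) (dist G x z)))
      next≡ : next (x , k) c (answer G (c ∷ x ∷ []) z) ≡
              (if dist G c y <ᵇ dist G x y then (c , 0) else (x , suc k))
      next≡ = trans (next-on-answer x k c z) (cong (λ b → if b then (c , 0) else (x , suc k)) (sym same-bit))
      outcome : Candidate (x , k) c → ∀ b → (dist G c y <ᵇ dist G x y) ≡ b →
                Confined (if b then (c , 0) else (x , suc k)) w
      outcome (inj₁ (child , _)) true bit = descend child c≼y y≢c st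
        where
          c≼y : c ≼ y
          c≼y with c ≼? y
          ... | yes c≼y = c≼y
          ... | no c⋠y  = ⊥-elim (<-asym (<ᵇ⇒< _ _ (subst T (sym bit) _)) (closer-to-parent child c⋠y))
      outcome (inj₁ (child , c≡k)) false bit = advance conf y≢x excluded st
        where
          excluded : ∀ c′ → IsChild x c′ → toℕ c′ ≡ k → ¬ c′ ≼ y
          excluded c′ _ c′≡k c′≼y =
            subst T bit (<⇒<ᵇ (closer-to-child child (subst (_≼ y) (toℕ-injective (trans c′≡k (sym c≡k))) c′≼y)))
      outcome (inj₂ (c≡x , _)) true bit =
        ⊥-elim (<-irrefl (cong (λ v → dist G v y) c≡x) (<ᵇ⇒< _ _ (subst T (sym bit) _)))
      outcome (inj₂ (_ , none)) false _ = advance conf y≢x (λ c′ child c′≡k _ → none c′ child c′≡k) st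

  -- Lexicographic progress measure: deeper x first, then larger k.
  measure : State → ℕ
  measure (x , k) = (n ∸ depth x) * suc n + (n ∸ k)

  measure-descend : ∀ {x k c} → IsChild x c → measure (c , 0) < measure (x , k)
  measure-descend {x} {k} {c} (_ , dc) = begin-strict
    (n ∸ depth c) * suc n + n       <⟨ +-monoʳ-< ((n ∸ depth c) * suc n) (n<1+n n) ⟩
    (n ∸ depth c) * suc n + suc n   ≡⟨ +-comm ((n ∸ depth c) * suc n) (suc n) ⟩
    suc (n ∸ depth c) * suc n       ≡⟨ cong (_* suc n) gap ⟨
    (n ∸ depth x) * suc n           ≤⟨ m≤m+n ((n ∸ depth x) * suc n) (n ∸ k) ⟩
    (n ∸ depth x) * suc n + (n ∸ k) ∎
    where
      open ≤-Reasoning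
      gap : n ∸ depth x ≡ suc (n ∸ depth c)
      gap = trans (∸-gap (subst (_≤ n) dc (dist-≤-n c ρ))) (cong (λ d → suc (n ∸ d)) (sym dc))

  measure-advance : ∀ {x k} → k < n → measure (x , suc k) < measure (x , k)
  measure-advance {x} {k} k<n = +-monoʳ-< ((n ∸ depth x) * suc n) (∸-monoʳ-< (n<1+n k) k<n)

  progress : ∀ {x k c z} → Candidate (x , k) c → Confined (x , k) z → z ≢ x →
             measure (next (x , k) c (answer G (c ∷ x ∷ []) z)) < measure (x , k)
  progress {x} {k} {c} {z} cand conf z≢x =
    subst (λ s → measure s < measure (x , k)) (sym (next-on-answer x k c z)) (gain cand (dist G c z <ᵇ dist G x z) refl)
    where
      gain : Candidate (x , k) c → ∀ b → (dist G c z <ᵇ dist G x z) ≡ b →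
             measure (if b then (c , 0) else (x , suc k)) < measure (x , k)
      gain (inj₁ (child , _)) true  _ = measure-descend {k = k} child
      gain (inj₁ (_ , c≡k))   false _ = measure-advance (subst (_< n) c≡k (toℕ<n c))
      gain (inj₂ (c≡x , _))   true  bit =
        ⊥-elim (<-irrefl (cong (λ v → dist G v z) c≡x) (<ᵇ⇒< _ _ (subst T (sym bit) _)))
      gain (inj₂ (_ , none))  false _ = measure-advance (k<n conf)
        where
          k<n : Confined (x , k) z → k < n
          k<n (inj₁ z≡x) = ⊥-elim (z≢x z≡x)
          k<n (inj₂ (c′ , child , k≤c′ , _)) = <-≤-trans (≤∧≢⇒< k≤c′ (λ k≡c′ → none c′ child (sym k≡c′))) (<⇒≤ (toℕ<n c′))

  now : (ℕ → Fin n) → ℕ → State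
  now r t = state (history G cop r t)

  Invariant : (ℕ → Fin n) → ℕ → Set
  Invariant r t = ∀ r′ → RobberWalk G {2} r′ → history G cop r′ t ≡ history G cop r t → Confined (now r t) (r′ t)

  same-turn : ∀ r r′ t → history G cop r′ (suc t) ≡ history G cop r (suc t) →
              history G cop r′ t ≡ history G cop r t ×
              answer G (cop (history G cop r t)) (r′ t) ≡ answer G (cop (history G cop r t)) (r t)
  same-turn r r′ t same with ∷-injective same
  ... | heads , tails = tails , subst (λ h → answer G (cop h) (r′ t) ≡ _) tails heads

  located : ∀ r t i → r t ≡ lookup (cop (history G cop r t)) i → LocatedAt G cop r t
  located r t i hit r′ _ same = probe-hit (cop (history G cop r t)) i (proj₂ (same-turn r r′ t same)) hit

  invariant-step : ∀ r t → Invariant r t → r t ≢ candidate (now r t) → r t ≢ proj₁ (now r t) → Invariant r (suc t)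
  invariant-step r t inv miss-c miss-x r′ walk′ same =
    let tails , heads = same-turn r r′ t same
    in turn (candidate-spec (now r t)) (inv r′ walk′ tails) heads miss-c miss-x (walk′ t)

  chase : ∀ r → RobberWalk G {2} r → ∀ t → Acc _<_ (measure (now r t)) → Invariant r t → ∃ (LocatedAt G cop r)
  chase r walk t (acc smaller) inv with r t ≟ candidate (now r t) | r t ≟ proj₁ (now r t)
  ... | yes hit   | _         = t , located r t zero hit
  ... | no _      | yes hit   = t , located r t (suc zero) hit
  ... | no miss-c | no miss-x =
    chase r walk (suc t) (smaller (progress (candidate-spec (now r t)) (inv r walk refl) miss-x))
      (invariant-step r t inv miss-c miss-x)

  cop-wins : CopWins G 2
  cop-wins = cop , λ r walk → chase r walk 0 (<-wellFounded _) (λ r′ _ _ → confined-below (≼-root (r′ 0)))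

module LowerBound {n : ℕ} (G : Graph n) where
  open Distance G

  -- Without probes every answer is empty: two stationary robbers at distinct
  -- vertices have identical histories.
  no-win-0 : ∀ {a b : Fin n} → a ≢ b → ¬ CopWins G 0
  no-win-0 {a} {b} a≢b (σ , wins) =
    let t , locatedAt = wins (λ _ → a) (λ _ → inj₁ refl)
    in a≢b (sym (locatedAt (λ _ → b) (λ _ → inj₁ refl) (silent (suc t))))
    where
      silent : ∀ t → history G σ (λ _ → b) t ≡ history G σ (λ _ → a) t
      silent zero    = refl
      silent (suc t) = cong (([] , []) ∷_) (silent t)

  module _ {a b c : Fin n} (ab : Adj G a b) (bc : Adj G b c) (a≢c : a ≢ c) where
    a≢b : a ≢ b
    a≢b = Adj-irrefl ab
    b≢c : b ≢ c
    b≢c = Adj-irrefl bc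

    -- Against a probe at v, the low robber stands on {a, b} and the high
    -- robber on {b, c}, both away from v and away from each other.

    low : Fin n → Fin n
    low v with v ≟ a
    ... | yes _ = b
    ... | no _  = a

    high : Fin n → Fin n
    high v with v ≟ c
    ... | yes _ = b
    ... | no _  = c

    low-dodges : ∀ v → low v ≢ v
    low-dodges v with v ≟ a
    ... | yes v≡a = λ b≡v → a≢b (sym (trans b≡v v≡a))
    ... | no v≢a  = λ a≡v → v≢a (sym a≡v)

    high-dodges : ∀ v → high v ≢ v
    high-dodges v with v ≟ c
    ... | yes v≡c = λ b≡v → b≢c (trans b≡v v≡c)
    ... | no v≢c  = λ c≡v → v≢c (sym c≡v)

    low≢high : ∀ v → low v ≢ high v
    low≢high v with v ≟ a | v ≟ c
    ... | yes v≡a | yes v≡c = λ _ → a≢c (trans (sym v≡a) v≡c)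
    ... | yes _   | no _    = b≢c
    ... | no _    | yes _   = a≢b
    ... | no _    | no _    = a≢c

    -- Since a–b and b–c are edges, each robber can follow any sequence of probes.

    low-moves : ∀ v v′ → low v′ ≡ low v ⊎ Adj G (low v) (low v′)
    low-moves v v′ with v ≟ a | v′ ≟ a
    ... | yes _ | yes _ = inj₁ refl
    ... | yes _ | no _  = inj₂ (Adj-sym ab)
    ... | no _  | yes _ = inj₂ ab
    ... | no _  | no _  = inj₁ refl

    high-moves : ∀ v v′ → high v′ ≡ high v ⊎ Adj G (high v) (high v′)
    high-moves v v′ with v ≟ c | v′ ≟ c
    ... | yes _ | yes _ = inj₁ refl
    ... | yes _ | no _  = inj₂ bc
    ... | no _  | yes _ = inj₂ (Adj-sym bc)
    ... | no _  | no _  = inj₁ refl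

    silence : Answer 1
    silence = (false ∷ []) , ((nothing ∷ []) ∷ [])

    module Dodging (σ : CopStrategy G {1}) where
      -- the probe the Cop makes at turn t as long as it has only heard silence
      target : ℕ → Fin n
      target t = lookup (σ (replicate t silence)) zero

      unnoticed : ∀ r → (∀ t → r t ≢ target t) → ∀ t → history G σ r t ≡ replicate t silence
      unnoticed r dodge zero = refl
      unnoticed r dodge (suc t) rewrite unnoticed r dodge t =
        cong (λ bit → ((bit ∷ []) , ((nothing ∷ []) ∷ [])) ∷ replicate t silence) (miss-bit (dodge t ∘ sym))

    no-win-1 : ¬ CopWins G 1
    no-win-1 (σ , wins) =
      let t , locatedAt = wins (low ∘ target) (λ t → low-moves (target t) (target (suc t)))
      in low≢high (target t) (sym (locatedAt (high ∘ target) (λ t → high-moves (target t) (target (suc t)))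
                   (trans (unnoticed (high ∘ target) (high-dodges ∘ target) (suc t))
                          (sym (unnoticed (low ∘ target) (low-dodges ∘ target) (suc t))))))
      where open Dodging σ

  fewer-probes-lose : ThreePath G → ∀ k → k < 2 → ¬ CopWins G k
  fewer-probes-lose (_ , _ , _ , ab , _)        zero          _ = no-win-0 (Adj-irrefl ab)
  fewer-probes-lose (_ , _ , _ , ab , bc , a≢c) (suc zero)    _ = no-win-1 ab bc a≢c
  fewer-probes-lose _                           (suc (suc _)) (s≤s (s≤s ()))

mainTheorem5 : (n : ℕ) → 3 ≤ n → (T : Graph n) → IsTree T → ZetaStarIs T 2
mainTheorem5 (suc (suc (suc m))) (s≤s (s≤s (s≤s _))) T (connected , acyclic) =
  Strategy.cop-wins T connected acyclic zero ,
  LowerBound.fewer-probes-lose T (three-path (suc zero) (suc (suc zero)) (λ ()) (λ ()) (λ ()))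
  where open RootedTree T connected acyclic zero using (three-path)
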